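{- The following algorithm is sound: given a QBF $\Pi.\phi$ with universal variables $U$ and existential variables $E$, if it returns "true" then $\Pi.\phi$ is true, and if it returns "false" then $\Pi.\phi$ is false. Algorithm: set $A_0:=\{\alpha_0\}$ for an arbitrary full assignment $\alpha_0\colon U\to\{\top,\bot\}$, $S_0:=\emptyset$, $i:=1$. Repeat: (a) check satisfiability of $\bigwedge_{\alpha\in A_{i-1}}\phi^\alpha$; if unsatisfiable return false, otherwise let $\tau$ be a satisfying assignment (assigning all annotated variables $x^\alpha$, $x\in E$, $\alpha\in A_{i-1}$) and set $S_i:=S_{i-1}\cup\{(\tau|_{E^\alpha})^{ -\alpha}\mid \alpha\in A_{i-1}\}$; (b) check satisfiability of $\bigwedge_{\sigma\in S_i}\lnot\phi^\sigma$; if unsatisfiable return true, otherwise let $\rho$ be a satisfying assignment (assigning all $x^\sigma$, $x\in U$, $\sigma\in S_i$) and set $A_i:=A_{i-1}\cup\{(\rho|_{U^\sigma})^{ -\sigma}\mid\sigma\in S_i\}$; (c) increment $i$.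
   Context: A QBF is $\Pi.\phi$ where $\Pi=Q_1x_1\ldots Q_nx_n$ with $Q_i\in\{\forall,\exists\}$ and pairwise distinct variables, $X=\{x_1,\dots,x_n\}$, $\phi$ a propositional formula over $X$, with the standard semantics; $U$ ($E$) is the set of universally (existentially) quantified variables, and $x_i<_\Pi x_j$ iff $i<j$. An assignment for $Y$ is $\sigma\colon Y\to\{\top,\bot,\epsilon\}$ ($\epsilon$ = unassigned), full if it never takes value $\epsilon$; $\sigma|_Z$ is its restriction to $Z$ (value $\epsilon$ outside $Z$). Instantiation: for an assignment $\sigma$ on a subset of $X$ (extended by $\epsilon$), $\phi^\sigma$ is obtained from $\phi$ by replacing every $x$ with $\sigma(x)\neq\epsilon$ by $\sigma(x)$ (with propositional simplification), and every $x$ with $\sigma(x)=\epsilon$ by the annotated variable $x^\omega$, where $\omega=\sigma(x_{k_1})\cdots\sigma(x_{k_m})$ for $x_{k_1}<_\Pi\cdots<_\Pi x_{k_m}$ all variables preceding $x$, each $\epsilon$ contributing the empty word (empty annotation identifies $x^\omega$ with $x$). Annotated variables with the same name and annotation are the same variable, so different instantiations may share variables. Write $x^\sigma$ for the variable replacing $x$ in $\phi^\sigma$, $E^\sigma=\{x^\sigma: x\in E,\sigma(x)=\epsilon\}$, $U^\sigma=\{x^\sigma:x\in U,\sigma(x)=\epsilon\}$. For an assignment $\tau$ to annotated variables, $\tau^{ -\sigma}$ is the assignment $x\mapsto\tau(x^\sigma)$. -}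

module Defs where

open import Data.Bool using (Bool; true; false; _∧_; _∨_; not)
open import Data.Nat using (ℕ; suc)
open import Data.Fin using (Fin; zero; suc; _<?_)
open import Data.Vec using (Vec; []; _∷_; lookup)
open import Data.List using (List; []; _∷_; _++_; map; filter; catMaybes; [_])
open import Data.List.Relation.Unary.All using (All)
open import Data.List using (allFin)
open import Data.Maybe using (Maybe; just; nothing)
open import Data.Product using (_×_; _,_; Σ; ∃)
open import Relation.Binary.PropositionalEquality using (_≡_)
open import Relation.Nullary using (¬_)

data Form (V : Set) : Set where
  var  : V → Form V
  cst  : Bool → Form V
  neg  : Form V → Form V
  and  : Form V → Form V → Form V
  or   : Form V → Form V → Form V

evalF : {V : Set} → (V → Bool) → Form V → Bool
evalF τ (var x)   = τ x
evalF τ (cst b)   = b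
evalF τ (neg ψ)   = not (evalF τ ψ)
evalF τ (and ψ χ) = evalF τ ψ ∧ evalF τ χ
evalF τ (or ψ χ)  = evalF τ ψ ∨ evalF τ χ

substF : {V W : Set} → (V → Form W) → Form V → Form W
substF s (var x)   = s x
substF s (cst b)   = cst b
substF s (neg ψ)   = neg (substF s ψ)
substF s (and ψ χ) = and (substF s ψ) (substF s χ)
substF s (or ψ χ)  = or (substF s ψ) (substF s χ)

-- QBFs.  The prefix Π = Q_1 x_1 … Q_n x_n is a vector of quantifiers;
-- variable x_i is the element i of Fin n, so <_Π is the order on Fin n.

data Quant : Set where
  ∀q ∃q : Quant

Prefix : ℕ → Set
Prefix n = Vec Quant n

setFirst : {n : ℕ} → Bool → Form (Fin (suc n)) → Form (Fin n)
setFirst b = substF λ { zero → cst b ; (suc i) → var i }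

qbfValue : {n : ℕ} → Prefix n → Form (Fin n) → Bool
qbfValue []       φ = evalF (λ ()) φ
qbfValue (∀q ∷ Π) φ = qbfValue Π (setFirst false φ) ∧ qbfValue Π (setFirst true φ)
qbfValue (∃q ∷ Π) φ = qbfValue Π (setFirst false φ) ∨ qbfValue Π (setFirst true φ)

-- Assignments σ : X → {⊤,⊥,ε}  (nothing = ε)

Assign : ℕ → Set
Assign n = Fin n → Maybe Bool

AVar : ℕ → Set
AVar n = Fin n × List Bool

-- the annotation ω of x under σ: values of preceding variables in
-- prefix order, ε contributing the empty word
annot : {n : ℕ} → Assign n → Fin n → List Bool
annot {n} σ x = catMaybes (map σ (filter (_<? x) (allFin n)))

inst : {n : ℕ} → Assign n → Form (Fin n) → Form (AVar n)
inst σ = substF λ x → instVar (σ x) x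
  where
  instVar : Maybe Bool → _ → Form (AVar _)
  instVar (just b) x = cst b
  instVar nothing  x = var (x , annot σ x)

SatBy : {n : ℕ} → (AVar n → Bool) → List (Form (AVar n)) → Set
SatBy τ ψs = All (λ ψ → evalF τ ψ ≡ true) ψs

Sat : {n : ℕ} → List (Form (AVar n)) → Set
Sat {n} ψs = Σ (AVar n → Bool) λ τ → SatBy τ ψs

-- (τ|_{Q^σ})^{-σ} : for x quantified by q with σ(x)=ε, value τ(x^σ); else ε
pullback : {n : ℕ} → Prefix n → Quant → (AVar n → Bool) → Assign n → Assign n
pullback Π q τ σ x = pick (lookup Π x) q (σ x)
  where
  pick : Quant → Quant → Maybe Bool → Maybe Bool
  pick ∀q ∀q nothing = just (τ (x , annot σ x))
  pick ∃q ∃q nothing = just (τ (x , annot σ x))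
  pick _  _  _       = nothing

fullU : {n : ℕ} → Prefix n → (Fin n → Bool) → Assign n
fullU Π a x with lookup Π x
... | ∀q = just (a x)
... | ∃q = nothing

-- Loop Π φ A S r : starting an iteration with
-- A_{i-1} = A and S_{i-1} = S, the algorithm (with some choice of
-- satisfying assignments τ, ρ) eventually returns r.  Sets are
-- represented by lists, union by concatenation.

data Loop {n : ℕ} (Π : Prefix n) (φ : Form (Fin n))
          : List (Assign n) → List (Assign n) → Bool → Set where
  retFalse : ∀ {A S} →
    ¬ Sat (map (λ α → inst α φ) A) →
    Loop Π φ A S false
  retTrue : ∀ {A S} (τ : AVar n → Bool) →
    SatBy τ (map (λ α → inst α φ) A) →
    ¬ Sat (map (λ σ → neg (inst σ φ)) (S ++ map (pullback Π ∃q τ) A)) →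
    Loop Π φ A S true
  step : ∀ {A S r} (τ ρ : AVar n → Bool) →
    SatBy τ (map (λ α → inst α φ) A) →
    let S′ = S ++ map (pullback Π ∃q τ) A in
    SatBy ρ (map (λ σ → neg (inst σ φ)) S′) →
    Loop Π φ (A ++ map (pullback Π ∀q ρ) S′) S′ r →
    Loop Π φ A S r

Returns : {n : ℕ} → Prefix n → Form (Fin n) → Bool → Set
Returns {n} Π φ r = Σ (Fin n → Bool) λ a₀ → Loop Π φ [ fullU Π a₀ ] [] r

-- If Π.φ is true, the existential player has a winning strategy, and such a strategy is a single
-- assignment τ to annotated variables: τ(x^ω) is the move at x after the opponent's moves ω, and
-- an annotation records exactly the values of the variables before x. Such a τ satisfies φ^α for
-- every full universal assignment α, so check (a) never fails and the algorithm cannot return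
-- false. Dually, if Π.φ is false, a universal winning strategy satisfies ¬φ^σ for every full
-- existential assignment σ, so check (b) never fails. The pullbacks keep every element of A_i a
-- full universal assignment and every element of S_i a full existential one.

module Submission where

open import Defs
open import Data.Bool using (Bool; true; false; _∧_; _∨_; not)
open import Data.Nat using (ℕ; suc)
open import Data.Fin using (Fin; zero; suc; _<?_)
open import Data.List using (List; []; _∷_; _++_; map; filter; catMaybes; allFin; tabulate; [_])
open import Data.List.Properties using (catMaybes-++; map-∘; map-tabulate)
open import Data.List.Relation.Unary.All as All using (All; []; _∷_)
open import Data.List.Relation.Unary.All.Properties using (map⁺; ++⁺)
open import Data.Maybe using (Maybe; just; nothing; fromMaybe)
open import Data.Product using (Σ; ∃; _,_; proj₁; proj₂)
open import Data.Sum using (_⊎_; inj₁; inj₂)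
open import Data.Vec using ([]; _∷_; lookup)
import Data.Vec.Functional as Vector
open import Data.Empty using (⊥-elim)
open import Function using (id; _∘_)
open import Relation.Nullary using (does)
open import Relation.Binary.PropositionalEquality using (_≡_; refl; sym; trans; cong; cong₂; _≗_; module ≡-Reasoning)

filter-<-suc : ∀ {n m} (i : Fin m) (xs : List (Fin n)) → filter (_<? suc i) (map suc xs) ≡ map suc (filter (_<? i) xs)
filter-<-suc i [] = refl
-- x <? i and suc x <? suc i compute the same boolean, so one with-abstraction covers both.
filter-<-suc i (x ∷ xs) with does (x <? i)
... | true  = cong (suc x ∷_) (filter-<-suc i xs)
... | false = filter-<-suc i xs

annot-suc : ∀ {n} (σ : Assign (suc n)) (i : Fin n) → annot σ (suc i) ≡ catMaybes [ σ zero ] ++ annot (σ ∘ suc) i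
annot-suc {n} σ i =
  trans (catMaybes-++ [ σ zero ] (map σ (filter (_<? suc i) (tabulate suc))))
        (cong (catMaybes [ σ zero ] ++_) (cong catMaybes later-values))
  where
  open ≡-Reasoning
  later-values : map σ (filter (_<? suc i) (tabulate suc)) ≡ map (σ ∘ suc) (filter (_<? i) (allFin n))
  later-values = begin
    map σ (filter (_<? suc i) (tabulate suc))        ≡⟨ cong (map σ ∘ filter (_<? suc i)) (sym (map-tabulate id suc)) ⟩
    map σ (filter (_<? suc i) (map suc (allFin n)))  ≡⟨ cong (map σ) (filter-<-suc i (allFin n)) ⟩
    map σ (map suc (filter (_<? i) (allFin n)))      ≡⟨ map-∘ (filter (_<? i) (allFin n)) ⟨
    map (σ ∘ suc) (filter (_<? i) (allFin n))        ∎

evalF-cong : ∀ {V} {f g : V → Bool} → f ≗ g → ∀ φ → evalF f φ ≡ evalF g φ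
evalF-cong f≗g (var x)   = f≗g x
evalF-cong f≗g (cst b)   = refl
evalF-cong f≗g (neg φ)   = cong not (evalF-cong f≗g φ)
evalF-cong f≗g (and φ ψ) = cong₂ _∧_ (evalF-cong f≗g φ) (evalF-cong f≗g ψ)
evalF-cong f≗g (or φ ψ)  = cong₂ _∨_ (evalF-cong f≗g φ) (evalF-cong f≗g ψ)

evalF-substF : ∀ {V W} (τ : W → Bool) (s : V → Form W) φ → evalF τ (substF s φ) ≡ evalF (evalF τ ∘ s) φ
evalF-substF τ s (var x)   = refl
evalF-substF τ s (cst b)   = refl
evalF-substF τ s (neg φ)   = cong not (evalF-substF τ s φ)
evalF-substF τ s (and φ ψ) = cong₂ _∧_ (evalF-substF τ s φ) (evalF-substF τ s ψ)
evalF-substF τ s (or φ ψ)  = cong₂ _∨_ (evalF-substF τ s φ) (evalF-substF τ s ψ)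

evalF-setFirst : ∀ {n} (v : Fin n → Bool) b φ → evalF v (setFirst b φ) ≡ evalF (b Vector.∷ v) φ
evalF-setFirst v b φ = trans (evalF-substF v _ φ) (evalF-cong (λ { zero → refl ; (suc i) → refl }) φ)

fill : ∀ {n} → Assign n → (AVar n → Bool) → Fin n → Bool
fill σ τ x = fromMaybe (τ (x , annot σ x)) (σ x)

evalF-inst : ∀ {n} (τ : AVar n → Bool) σ φ → evalF τ (inst σ φ) ≡ evalF (fill σ τ) φ
evalF-inst τ σ φ = trans (evalF-substF τ _ φ) (evalF-cong instantiated-value φ)
  where
  instantiated-value : evalF τ ∘ inst σ ∘ var ≗ fill σ τ
  instantiated-value x with σ x
  ... | just b  = refl
  ... | nothing = refl

opponent : Quant → Quant
opponent ∀q = ∃q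
opponent ∃q = ∀q

goal : Quant → Bool
goal ∀q = false
goal ∃q = true

qbfValue-∷-own : ∀ {n} e (Π : Prefix n) φ →
  qbfValue (e ∷ Π) φ ≡ goal e → ∃ λ b → qbfValue Π (setFirst b φ) ≡ goal e
qbfValue-∷-own ∀q Π φ v with qbfValue Π (setFirst false φ) in v₀
... | false = false , v₀
... | true  = true , v
qbfValue-∷-own ∃q Π φ v with qbfValue Π (setFirst false φ) in v₀
... | true  = false , v₀
... | false = true , v

qbfValue-∷-opponent : ∀ {n} e (Π : Prefix n) φ →
  qbfValue (opponent e ∷ Π) φ ≡ goal e → ∀ b → qbfValue Π (setFirst b φ) ≡ goal e
qbfValue-∷-opponent ∀q Π φ v b with qbfValue Π (setFirst false φ) in v₀
qbfValue-∷-opponent ∀q Π φ v false | false = v₀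
qbfValue-∷-opponent ∀q Π φ v true  | false = v
qbfValue-∷-opponent ∀q Π φ () b    | true
qbfValue-∷-opponent ∃q Π φ v b with qbfValue Π (setFirst false φ) in v₀
qbfValue-∷-opponent ∃q Π φ v false | true  = v₀
qbfValue-∷-opponent ∃q Π φ v true  | true  = v
qbfValue-∷-opponent ∃q Π φ () b    | false

FixedAt : Quant → Quant → Maybe Bool → Set
FixedAt ∀q ∀q m = ∃ λ b → m ≡ just b
FixedAt ∃q ∃q m = ∃ λ b → m ≡ just b
FixedAt ∀q ∃q m = m ≡ nothing
FixedAt ∃q ∀q m = m ≡ nothing

FixesExactly : ∀ {n} → Prefix n → Quant → Assign n → Set
FixesExactly Π q σ = ∀ x → FixedAt q (lookup Π x) (σ x)

fixedAt-self : ∀ q {m} → FixedAt q q m → ∃ λ b → m ≡ just b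
fixedAt-self ∀q fixed = fixed
fixedAt-self ∃q fixed = fixed

fixedAt-opponent : ∀ q {m} → FixedAt (opponent q) q m → m ≡ nothing
fixedAt-opponent ∀q fixed = fixed
fixedAt-opponent ∃q fixed = fixed

WinningStrategy : ∀ {n} → Prefix n → Form (Fin n) → Quant → Set
WinningStrategy {n} Π φ e =
  Σ (AVar n → Bool) λ τ → ∀ σ → FixesExactly Π (opponent e) σ → evalF (fill σ τ) φ ≡ goal e

commit : ∀ {n} → Bool → (AVar n → Bool) → AVar (suc n) → Bool
commit b τ (zero  , ω) = b
commit b τ (suc i , ω) = τ (i , ω)

-- The annotation of every later variable starts with the value of the first one, which selects the
-- sub-strategy; the values at the first variable and at empty annotations are never consulted.
branch : ∀ {n} → (Bool → AVar n → Bool) → AVar (suc n) → Bool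
branch τ (zero  , ω)     = false
branch τ (suc i , [])    = false
branch τ (suc i , b ∷ ω) = τ b (i , ω)

fill-commit : ∀ {n} (σ : Assign (suc n)) b τ → σ zero ≡ nothing →
  fill σ (commit b τ) ≗ b Vector.∷ fill (σ ∘ suc) τ
fill-commit σ b τ σ₀ zero    = cong (fromMaybe b) σ₀
fill-commit σ b τ σ₀ (suc i) =
  cong (λ ω → fromMaybe (τ (i , ω)) (σ (suc i)))
       (trans (annot-suc σ i) (cong (λ m → catMaybes [ m ] ++ annot (σ ∘ suc) i) σ₀))

fill-branch : ∀ {n} (σ : Assign (suc n)) b τ → σ zero ≡ just b →
  fill σ (branch τ) ≗ b Vector.∷ fill (σ ∘ suc) (τ b)
fill-branch σ b τ σ₀ zero    = cong (fromMaybe false) σ₀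
fill-branch σ b τ σ₀ (suc i) =
  cong (λ ω → fromMaybe (branch τ (suc i , ω)) (σ (suc i)))
       (trans (annot-suc σ i) (cong (λ m → catMaybes [ m ] ++ annot (σ ∘ suc) i) σ₀))

evalF-fill-∷ : ∀ {n} (σ : Assign (suc n)) τ τ₀ b φ →
  fill σ τ ≗ b Vector.∷ fill (σ ∘ suc) τ₀ →
  evalF (fill σ τ) φ ≡ evalF (fill (σ ∘ suc) τ₀) (setFirst b φ)
evalF-fill-∷ σ τ τ₀ b φ fill≗ = trans (evalF-cong fill≗ φ) (sym (evalF-setFirst (fill (σ ∘ suc) τ₀) b φ))

strategy-∷-own : ∀ {n} e (Π : Prefix n) φ b →
  WinningStrategy Π (setFirst b φ) e → WinningStrategy (e ∷ Π) φ e
strategy-∷-own e Π φ b (τ , wins) = commit b τ , λ σ fixes →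
  let σ₀ = fixedAt-opponent e (fixes zero) in
  trans (evalF-fill-∷ σ (commit b τ) τ b φ (fill-commit σ b τ σ₀)) (wins (σ ∘ suc) (fixes ∘ suc))

strategy-∷-opponent : ∀ {n} e (Π : Prefix n) φ →
  (∀ b → WinningStrategy Π (setFirst b φ) e) → WinningStrategy (opponent e ∷ Π) φ e
strategy-∷-opponent e Π φ strategies = branch (proj₁ ∘ strategies) , λ σ fixes →
  let b , σ₀ = fixedAt-self (opponent e) (fixes zero) in
  trans (evalF-fill-∷ σ (branch (proj₁ ∘ strategies)) (proj₁ (strategies b)) b φ
                      (fill-branch σ b (proj₁ ∘ strategies) σ₀))
        (proj₂ (strategies b) (σ ∘ suc) (fixes ∘ suc))

opponent-or-self : ∀ q e → q ≡ e ⊎ q ≡ opponent e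
opponent-or-self ∀q ∀q = inj₁ refl
opponent-or-self ∃q ∃q = inj₁ refl
opponent-or-self ∀q ∃q = inj₂ refl
opponent-or-self ∃q ∀q = inj₂ refl

strategy : ∀ {n} (Π : Prefix n) φ e → qbfValue Π φ ≡ goal e → WinningStrategy Π φ e
strategy []      φ e v = (λ _ → false) , λ σ _ → trans (evalF-cong (λ ()) φ) v
strategy (q ∷ Π) φ e v with opponent-or-self q e
... | inj₁ refl = let b , vb = qbfValue-∷-own e Π φ v in strategy-∷-own e Π φ b (strategy Π _ e vb)
... | inj₂ refl = strategy-∷-opponent e Π φ λ b → strategy Π _ e (qbfValue-∷-opponent e Π φ v b)

pullback-fixesExactly : ∀ {n} (Π : Prefix n) e τ {σ} →
  FixesExactly Π (opponent e) σ → FixesExactly Π e (pullback Π e τ σ)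
pullback-fixesExactly Π e τ {σ} fixes x with lookup Π x | σ x | fixes x
pullback-fixesExactly Π ∀q τ fixes x | ∀q | .nothing  | refl   = _ , refl
pullback-fixesExactly Π ∃q τ fixes x | ∃q | .nothing  | refl   = _ , refl
pullback-fixesExactly Π ∀q τ fixes x | ∃q | .(just b) | b , refl = refl
pullback-fixesExactly Π ∃q τ fixes x | ∀q | .(just b) | b , refl = refl

pullbacks-fixExactly : ∀ {n} (Π : Prefix n) e τ {σs} →
  All (FixesExactly Π (opponent e)) σs → All (FixesExactly Π e) (map (pullback Π e τ) σs)
pullbacks-fixExactly Π e τ = map⁺ ∘ All.map (pullback-fixesExactly Π e τ)

fullU-fixesExactly : ∀ {n} (Π : Prefix n) a → FixesExactly Π ∀q (fullU Π a)
fullU-fixesExactly Π a x with lookup Π x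
... | ∀q = a x , refl
... | ∃q = refl

module _ {n} {Π : Prefix n} {φ : Form (Fin n)} where

  strategy-satisfies : WinningStrategy Π φ ∃q → ∀ {A} → All (FixesExactly Π ∀q) A →
    Sat (map (λ α → inst α φ) A)
  strategy-satisfies (τ , wins) fixed =
    τ , map⁺ (All.map (λ {α} fixes → trans (evalF-inst τ α φ) (wins α fixes)) fixed)

  strategy-refutes : WinningStrategy Π φ ∀q → ∀ {S} → All (FixesExactly Π ∃q) S →
    Sat (map (λ σ → neg (inst σ φ)) S)
  strategy-refutes (ρ , wins) fixed =
    ρ , map⁺ (All.map (λ {σ} fixes → cong not (trans (evalF-inst ρ σ φ) (wins σ fixes))) fixed)

  loop-sound : ∀ {A S r} → All (FixesExactly Π ∀q) A → All (FixesExactly Π ∃q) S →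
    Loop Π φ A S r → qbfValue Π φ ≡ r
  loop-sound fixedA fixedS (retFalse unsat) with qbfValue Π φ in v
  ... | false = refl
  ... | true  = ⊥-elim (unsat (strategy-satisfies (strategy Π φ ∃q v) fixedA))
  loop-sound fixedA fixedS (retTrue τ _ unsat) with qbfValue Π φ in v
  ... | true  = refl
  ... | false = ⊥-elim (unsat (strategy-refutes (strategy Π φ ∀q v)
                                 (++⁺ fixedS (pullbacks-fixExactly Π ∃q τ fixedA))))
  loop-sound {A} {S} fixedA fixedS (step τ ρ _ _ run) =
    loop-sound (++⁺ fixedA (pullbacks-fixExactly Π ∀q ρ fixedS++)) fixedS++ run
    where
    fixedS++ : All (FixesExactly Π ∃q) (S ++ map (pullback Π ∃q τ) A)
    fixedS++ = ++⁺ fixedS (pullbacks-fixExactly Π ∃q τ fixedA)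

theorem1 : {n : ℕ} (Π : Prefix n) (φ : Form (Fin n)) (r : Bool) →
    Returns Π φ r → qbfValue Π φ ≡ r
theorem1 Π φ r (a₀ , run) = loop-sound (fullU-fixesExactly Π a₀ ∷ []) [] run
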